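{- Let $G$ be a graph with minimum degree $\delta$ and girth at least $5$. Then $ccn(G)\ge \delta$.
   Context: Game of Cops and Robbers: cops first choose vertices, then the robber; players then alternate, each cop (on the cops' turn) or the robber (on its turn) moving to an adjacent vertex or staying; capture occurs when a cop occupies the robber's vertex. The confining cop number $ccn(G)$ is the minimum number of cops that can force an arrangement of the cops and the robber in which the robber has to stay at its current vertex in order to avoid capture in the next move of the cops (capture also counts). -}

module Defs where

open import Data.Nat using (ℕ; _≤_)
open import Data.Fin using (Fin)
open import Data.List using (length; filter)
open import Data.List using (List)
open import Data.Empty using (⊥)
open import Data.Product using (Σ; ∃; _×_)
open import Data.Sum using (_⊎_)
open import Relation.Nullary using (¬_)
open import Relation.Binary using (Decidable)
open import Relation.Binary.PropositionalEquality using (_≡_; _≢_)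
import Data.List as L

record Graph (n : ℕ) : Set₁ where
  field
    Adj    : Fin n → Fin n → Set
    adj?   : Decidable Adj
    sym    : ∀ {u v} → Adj u v → Adj v u
    irrefl : ∀ {v} → ¬ Adj v v

module _ {n : ℕ} (G : Graph n) where
  open Graph G

  allVertices : List (Fin n)
  allVertices = L.allFin n

  deg : Fin n → ℕ
  deg v = length (filter (adj? v) allVertices)

  MinDegree : ℕ → Set
  MinDegree δ = (∀ v → δ ≤ deg v) × ∃ λ v → deg v ≡ δ

  -- girth at least 5: G has no cycle of length 3 or 4
  -- (cycles of length ≤ 2 do not exist in a simple graph)
  NoTriangle : Set
  NoTriangle = ∀ a b c → Adj a b → Adj b c → Adj c a → ⊥

  NoFourCycle : Set
  NoFourCycle = ∀ a b c d → a ≢ c → b ≢ d →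
                Adj a b → Adj b c → Adj c d → Adj d a → ⊥

  GirthAtLeast5 : Set
  GirthAtLeast5 = NoTriangle × NoFourCycle

  Step : Fin n → Fin n → Set
  Step u v = u ≡ v ⊎ Adj u v

  Cops : ℕ → Set
  Cops k = Fin k → Fin n

  CopsStep : ∀ {k} → Cops k → Cops k → Set
  CopsStep c c' = ∀ i → Step (c i) (c' i)

  -- Confining arrangement (robber to move): the robber is captured, or every
  -- move of the robber to an adjacent vertex leads to capture in the next
  -- move of the cops (i.e. every neighbour of the robber lies in the closed
  -- neighbourhood of some cop).
  Confined : ∀ {k} → Cops k → Fin n → Set
  Confined {k} c r =
    (∃ λ i → c i ≡ r) ⊎ (∀ w → Adj r w → ∃ λ (i : Fin k) → Step (c i) w)

  -- CopsForce c r : it is the cops' turn, cops at c, robber at r, and the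
  -- cops can force (in finitely many rounds) a confining arrangement.
  data CopsForce {k : ℕ} : Cops k → Fin n → Set where
    force : ∀ {c r} (c' : Cops k) → CopsStep c c' →
            (Confined c' r ⊎ (∀ r' → Step r r' → CopsForce c' r')) →
            CopsForce c r

  -- k cops can force a confining arrangement: cops choose positions, then the
  -- robber chooses a position, then the cops move first.
  KCopsConfine : ℕ → Set
  KCopsConfine k = ∃ λ (c : Cops k) → ∀ r → CopsForce c r

module Submission where

-- Call a robber vertex r safe from cops c if no cop can step onto r.  The key
-- observation is that in a graph without 3- and 4-cycles a vertex p ≠ r is
-- equal or adjacent to at most one neighbour of r.  So if the robber stands
-- on a safe vertex r and the k < deg r cops move (none of them can reach r),
-- then by pigeonhole some neighbour of r is neither occupied nor adjacent to
-- a cop: the arrangement is not confining, and the robber moves to that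
-- neighbour, which is again safe.  By induction on the cops' strategy
-- (CopsForce) the cops never force a confining arrangement.  A safe starting
-- vertex exists by the same pigeonhole argument applied twice: some vertex is
-- unoccupied, and some neighbour of it is safe.

open import Defs
open import Data.Nat using (ℕ; _≤_; _<_; _≤?_; s≤s)
open import Data.Nat.Properties using (<-≤-trans; ≰⇒>)
open import Data.Fin using (Fin; zero; suc; _≟_)
import Data.Fin as Fin
open import Data.Fin.Properties using (any?; pigeonhole)
open import Data.List using (List; _∷_; length; filter; lookup)
open import Data.List.Properties using (length-filter; length-tabulate)
import Data.List.Relation.Unary.All as All
open import Data.List.Relation.Unary.AllPairs using (_∷_)
open import Data.List.Relation.Unary.Unique.Propositional using (Unique)
open import Data.List.Relation.Unary.Unique.Propositional.Properties using (allFin⁺; filter⁺)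
open import Data.List.Membership.Propositional using (_∈_)
open import Data.List.Membership.Propositional.Properties using (∈-lookup; ∈-filter⁻)
open import Data.Empty using (⊥; ⊥-elim)
open import Data.Product using (∃; ∃₂; _×_; _,_; proj₁; proj₂)
open import Data.Sum using (inj₁; inj₂)
open import Relation.Nullary using (¬_; Dec; yes; no; ¬?)
open import Relation.Nullary.Decidable using (decidable-stable)
open import Relation.Binary using (Decidable)
open import Relation.Binary.PropositionalEquality using (_≡_; _≢_; refl; sym; subst)

lookup-injective : ∀ {a} {A : Set a} (xs : List A) → Unique xs →
                   ∀ {i j} → i Fin.< j → lookup xs i ≢ lookup xs j
lookup-injective (_ ∷ _) (x∉xs ∷ _)  {zero}  {suc j} _ = All.lookup x∉xs (∈-lookup j)
lookup-injective (_ ∷ xs) (_ ∷ uniq) {suc i} {suc j} (s≤s i<j) =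
  lookup-injective xs uniq i<j

unrelated-member :
  ∀ {a r k} {A : Set a} (R : Fin k → A → Set r) → (∀ i x → Dec (R i x)) →
  (xs : List A) → Unique xs → k < length xs →
  (∀ i {x y} → x ∈ xs → y ∈ xs → x ≢ y → R i x → R i y → ⊥) →
  ∃ λ x → x ∈ xs × ∀ i → ¬ R i x
unrelated-member {k = k} R R? xs uniq k<len at-most-one
  with any? (λ j → ¬? (any? (λ i → R? i (lookup xs j))))
... | yes (j , unrelated) = lookup xs j , ∈-lookup j , λ i rel → unrelated (i , rel)
... | no all-related = ⊥-elim (collision (pigeonhole k<len (λ j → proj₁ (witness j))))
  where
  witness : ∀ j → ∃ λ i → R i (lookup xs j)
  witness j = decidable-stable (any? (λ i → R? i (lookup xs j)))
                               (λ none → all-related (j , none))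

  collision : (∃₂ λ j j' → j Fin.< j' × proj₁ (witness j) ≡ proj₁ (witness j')) → ⊥
  collision (j , j' , j<j' , same) =
    at-most-one (proj₁ (witness j)) (∈-lookup j) (∈-lookup j')
      (lookup-injective xs uniq j<j') (proj₂ (witness j))
      (subst (λ i → R i (lookup xs j')) (sym same) (proj₂ (witness j')))

module _ {n : ℕ} (G : Graph n) where
  open Graph G using (Adj; adj?) renaming (sym to adj-sym)

  step? : Decidable (Step G)
  step? u v with u ≟ v | adj? u v
  ... | yes u≡v | _       = yes (inj₁ u≡v)
  ... | no  _   | yes u~v = yes (inj₂ u~v)
  ... | no  u≢v | no  u≁v = no λ { (inj₁ u≡v) → u≢v u≡v ; (inj₂ u~v) → u≁v u~v }

  neighbours : Fin n → List (Fin n)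
  neighbours r = filter (adj? r) (allVertices G)

  neighbours-unique : ∀ r → Unique (neighbours r)
  neighbours-unique r = filter⁺ (adj? r) (allFin⁺ n)

  neighbour-adjacent : ∀ {r w} → w ∈ neighbours r → Adj r w
  neighbour-adjacent {r} w∈ = proj₂ (∈-filter⁻ (adj? r) {xs = allVertices G} w∈)

  number-of-vertices : length (allVertices G) ≡ n
  number-of-vertices = length-tabulate (λ v → v)

  deg≤n : ∀ v → deg G v ≤ n
  deg≤n v = subst (deg G v ≤_) number-of-vertices (length-filter (adj? v) (allVertices G))

  Safe : ∀ {k} → Cops G k → Fin n → Set
  Safe c r = ∀ i → ¬ Step G (c i) r

  unoccupied-after-move : ∀ {k} {c c' : Cops G k} {r} → Safe c r → CopsStep G c c' →
                          ∀ i → c' i ≢ r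
  unoccupied-after-move safe move i c'i≡r = safe i (subst (Step G _) c'i≡r (move i))

  unoccupied-vertex : ∀ {k} (c : Cops G k) → k < n → ∃ λ v → ∀ i → c i ≢ v
  unoccupied-vertex c k<n with unrelated-member (λ i v → c i ≡ v) (λ i v → c i ≟ v)
    (allVertices G) (allFin⁺ n) (subst (_ <_) (sym number-of-vertices) k<n)
    (λ { _ _ _ x≢y refl refl → x≢y refl })
  ... | v , _ , unoccupied = v , unoccupied

  module _ (girth≥5 : GirthAtLeast5 G) where

    covers-at-most-one : ∀ {r p x y} → p ≢ r → Adj r x → Adj r y → x ≢ y →
                         Step G p x → Step G p y → ⊥
    covers-at-most-one _   _   _   x≢y (inj₁ refl) (inj₁ refl) = x≢y refl
    covers-at-most-one _   r~x r~y _   (inj₁ refl) (inj₂ x~y)  =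
      proj₁ girth≥5 _ _ _ r~x x~y (adj-sym r~y)
    covers-at-most-one _   r~x r~y _   (inj₂ y~x)  (inj₁ refl) =
      proj₁ girth≥5 _ _ _ r~y y~x (adj-sym r~x)
    covers-at-most-one p≢r r~x r~y x≢y (inj₂ p~x)  (inj₂ p~y)  =
      proj₂ girth≥5 _ _ _ _ (λ r≡p → p≢r (sym r≡p)) x≢y r~x (adj-sym p~x) p~y (adj-sym r~y)

    safe-neighbour : ∀ {k} (c : Cops G k) r → k < deg G r → (∀ i → c i ≢ r) →
                     ∃ λ w → Adj r w × Safe c w
    safe-neighbour c r k<deg unoccupied
      with unrelated-member (λ i w → Step G (c i) w) (λ i w → step? (c i) w)
             (neighbours r) (neighbours-unique r) k<deg
             (λ i x∈ y∈ → covers-at-most-one (unoccupied i)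
                            (neighbour-adjacent x∈) (neighbour-adjacent y∈))
    ... | w , w∈ , safe = w , neighbour-adjacent w∈ , safe

    robber-evades : ∀ {k} → (∀ v → k < deg G v) →
                    ∀ {c : Cops G k} {r} → Safe c r → ¬ CopsForce G c r
    robber-evades k<deg safe (force c' move outcome)
      with unoccupied-after-move safe move
    ... | unoccupied with safe-neighbour c' _ (k<deg _) unoccupied | outcome
    ...   | _ , _   , _      | inj₁ (inj₁ (i , caught)) = unoccupied i caught
    ...   | w , r~w , w-safe | inj₁ (inj₂ confined)     =
      let (i , covered) = confined w r~w in w-safe i covered
    ...   | w , r~w , w-safe | inj₂ continue           =
      robber-evades k<deg w-safe (continue w (inj₂ r~w))

    safe-start : ∀ {k} → (∀ v → k < deg G v) → k < n → (c : Cops G k) →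
                 ∃ λ r → Safe c r
    safe-start k<deg k<n c with unoccupied-vertex c k<n
    ... | v , unoccupied with safe-neighbour c v (k<deg v) unoccupied
    ...   | w , _ , safe = w , safe

    too-few-cops : ∀ {k} → (∀ v → k < deg G v) → k < n → ¬ KCopsConfine G k
    too-few-cops k<deg k<n (c , cops-win) with safe-start k<deg k<n c
    ... | r , safe = robber-evades k<deg safe (cops-win r)

proposition1p10 : ∀ {n} (G : Graph n) (δ : ℕ) → MinDegree G δ → GirthAtLeast5 G →
    ∀ k → KCopsConfine G k → δ ≤ k
proposition1p10 {n} G δ (δ≤deg , v₀ , _) girth≥5 k confine with δ ≤? k
... | yes δ≤k = δ≤k
... | no  δ≰k = ⊥-elim (too-few-cops G girth≥5 k<deg k<n confine)
  where
  k<deg : ∀ v → k < deg G v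
  k<deg v = <-≤-trans (≰⇒> δ≰k) (δ≤deg v)

  k<n : k < n
  k<n = <-≤-trans (k<deg v₀) (deg≤n G v₀)
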